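{- Let $m,n\ge1$, let $(u_{i,j})$ be a positive integral $(m,n)$-periodic $SL_2$-tiling, and let $(v_{k,l})_{l\ge k}$ be the infinite frieze pattern with $v_{k-1,k+1}=\frac{u_{k-1,j_0}+u_{k+1,j_0}}{u_{k,j_0}}$ for all $k$ (this does not depend on $j_0$). Then for all $k\le l$ and every $j\in\mathbb Z$, $$v_{k,l}=-\begin{vmatrix} u_{k,j} & u_{k,j+1}\\ u_{l,j} & u_{l,j+1}\end{vmatrix}.$$
   Context: An $SL_2$-tiling is a family $(u_{i,j})_{i,j\in\mathbb Z}$ of reals with $u_{i+1,j}u_{i,j+1}-u_{i,j}u_{i+1,j+1}=1$ for all $i,j$; positive integral if all entries are positive integers; $(m,n)$-periodic if $u_{i+m,j+n}=u_{i,j}$ for all $i,j$. An infinite frieze pattern is a family $(v_{k,l})_{k,l\in\mathbb Z,\ l\ge k}$ with $v_{k,k}=0$, $v_{k,k+1}=1$ and $v_{k,l}v_{k+1,l+1}-v_{k,l+1}v_{k+1,l}=1$ whenever defined; it is uniquely determined by its quiddity sequence $(v_{k,k+2})_k$. -}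

module Defs where

open import Data.Nat using (ℕ)
open import Data.Integer as ℤ using (ℤ; +_)
open import Data.Rational as ℚ using (ℚ; 0ℚ; 1ℚ)
open import Relation.Binary.PropositionalEquality using (_≡_)
open import Data.Product using (_×_)

toℚ : ℤ → ℚ
toℚ z = z ℚ./ 1

IsSL2Tiling : (ℤ → ℤ → ℤ) → Set
IsSL2Tiling u = ∀ i j →
  u (i ℤ.+ + 1) j ℤ.* u i (j ℤ.+ + 1) ℤ.- u i j ℤ.* u (i ℤ.+ + 1) (j ℤ.+ + 1) ≡ + 1

IsPositive : (ℤ → ℤ → ℤ) → Set
IsPositive u = ∀ i j → + 0 ℤ.< u i j

IsPeriodic : ℕ → ℕ → (ℤ → ℤ → ℤ) → Set
IsPeriodic m n u = ∀ i j → u (i ℤ.+ + m) (j ℤ.+ + n) ≡ u i j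

-- infinite frieze pattern; v is given on all of ℤ×ℤ but only the values
-- with l ≥ k are constrained (the rest is irrelevant)
IsInfiniteFrieze : (ℤ → ℤ → ℚ) → Set
IsInfiniteFrieze v =
  (∀ k → v k k ≡ 0ℚ) ×
  (∀ k → v k (k ℤ.+ + 1) ≡ 1ℚ) ×
  (∀ k l → k ℤ.< l →
     v k l ℚ.* v (k ℤ.+ + 1) (l ℤ.+ + 1) ℚ.- v k (l ℤ.+ + 1) ℚ.* v (k ℤ.+ + 1) l ≡ 1ℚ)

det2 : ℤ → ℤ → ℤ → ℤ → ℤ
det2 a b c d = a ℤ.* d ℤ.- b ℤ.* c

{-# OPTIONS --safe #-}
-- Fix a column j and let w(k,l) be minus the minor of u on rows k, l and
-- columns j, j+1.  Then w is an infinite frieze: w(k,k) = 0, the SL₂ relation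
-- gives w(k,k+1) = 1, and the unimodular rule is a Plücker relation.  Both
-- columns j and j+1 satisfy the three-term relation
-- w(a,c) u_b = w(b,c) u_a + w(a,b) u_c, so w(k,k+2) u_{k+1} = u_k + u_{k+2};
-- as column j+1 is shared by the friezes at j and j+1, this quiddity does not
-- depend on j and hence agrees with that of v.  The three-term relation also
-- propagates positivity, so w(k,l) > 0 for k < l, and a frieze whose entries
-- above the diagonal are nonzero is determined by its quiddity, row by row,
-- through the unimodular rule.  Hence v = w.

module Submission where

open import Defs
open import Data.Nat using (ℕ; _≥_)
open import Data.Integer as ℤ using (ℤ; +_; _≤_)
open import Data.Rational as ℚ using (ℚ)
open import Relation.Binary.PropositionalEquality using (_≡_)

open import Level using (Level)
open import Data.Nat as ℕ using (zero; suc)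
import Data.Nat.Properties as ℕP
open import Data.Integer using (0ℤ; 1ℤ; _<_; +<+)
import Data.Integer.Properties as ℤP
open import Data.Integer.Solver using (module +-*-Solver)
open import Data.Integer.Tactic.RingSolver using (solve-∀)
open import Data.Rational using (mkℚ; 0ℚ; 1ℚ; 1/_)
import Data.Rational.Properties as ℚP
import Data.Nat.Coprimality as Coprime
import Algebra.Properties.Group as GroupProperties
open import Data.Product using (∃-syntax; _×_; _,_; proj₁; proj₂)
open import Data.Sum using (inj₁; inj₂)
open import Relation.Binary.PropositionalEquality
  using (_≢_; refl; sym; trans; cong; cong₂; subst; subst₂; module ≡-Reasoning)

open ≡-Reasoning

private
  variable
    ℓ : Level
    A : Set ℓ
    i j : ℤ

i+1+n≡i+[1+n] : ∀ i n → (i ℤ.+ + 1) ℤ.+ + n ≡ i ℤ.+ + suc n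
i+1+n≡i+[1+n] i n = ℤP.+-assoc i (+ 1) (+ n)

i+[1+n]≡i+n+1 : ∀ i n → i ℤ.+ + suc n ≡ (i ℤ.+ + n) ℤ.+ + 1
i+[1+n]≡i+n+1 i n =
  trans (cong (λ m → i ℤ.+ + m) (ℕP.+-comm 1 n)) (sym (ℤP.+-assoc i (+ n) (+ 1)))

i+1-1≡i : ∀ i → (i ℤ.+ + 1) ℤ.- + 1 ≡ i
i+1-1≡i = solve-∀

i<i+[1+n] : ∀ i n → i < i ℤ.+ + suc n
i<i+[1+n] i n = subst (_< i ℤ.+ + suc n) (ℤP.+-identityʳ i) (ℤP.+-monoʳ-< i (+<+ ℕ.z<s))

i≤j⇒∃[n]i+n≡j : i ≤ j → ∃[ n ] i ℤ.+ + n ≡ j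
i≤j⇒∃[n]i+n≡j {i} {j} i≤j = ℤ.∣ j ℤ.- i ∣ , (begin
  i ℤ.+ + ℤ.∣ j ℤ.- i ∣  ≡⟨ cong (λ m → i ℤ.+ m) (ℤP.0≤i⇒+∣i∣≡i (ℤP.i≤j⇒0≤j-i i≤j)) ⟩
  i ℤ.+ (j ℤ.- i)        ≡⟨ i+[j-i]≡j i j ⟩
  j                      ∎)
  where
  i+[j-i]≡j : ∀ i j → i ℤ.+ (j ℤ.- i) ≡ j
  i+[j-i]≡j = solve-∀

i<j⇒∃[n]i+[1+n]≡j : i < j → ∃[ n ] i ℤ.+ + suc n ≡ j
i<j⇒∃[n]i+[1+n]≡j {i} i<j with i≤j⇒∃[n]i+n≡j (ℤP.i<j⇒suc[i]≤j i<j)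
... | n , 1+i+n≡j = n , trans (reassoc i (+ n)) 1+i+n≡j
  where
  reassoc : ∀ i m → i ℤ.+ (+ 1 ℤ.+ m) ≡ (+ 1 ℤ.+ i) ℤ.+ m
  reassoc = solve-∀

stepInvariant⇒shiftInvariant : (f : ℤ → A) → (∀ i → f (i ℤ.+ + 1) ≡ f i) →
                               ∀ i n → f (i ℤ.+ + n) ≡ f i
stepInvariant⇒shiftInvariant f step i zero    = cong f (ℤP.+-identityʳ i)
stepInvariant⇒shiftInvariant f step i (suc n) = begin
  f (i ℤ.+ + suc n)           ≡⟨ cong f (i+[1+n]≡i+n+1 i n) ⟩
  f ((i ℤ.+ + n) ℤ.+ + 1)     ≡⟨ step (i ℤ.+ + n) ⟩
  f (i ℤ.+ + n)               ≡⟨ stepInvariant⇒shiftInvariant f step i n ⟩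
  f i                         ∎

stepInvariant⇒constant : (f : ℤ → A) → (∀ i → f (i ℤ.+ + 1) ≡ f i) → ∀ i j → f i ≡ f j
stepInvariant⇒constant f step i j with ℤP.≤-total i j
... | inj₁ i≤j = let n , i+n≡j = i≤j⇒∃[n]i+n≡j i≤j in
  sym (trans (cong f (sym i+n≡j)) (stepInvariant⇒shiftInvariant f step i n))
... | inj₂ j≤i = let n , j+n≡i = i≤j⇒∃[n]i+n≡j j≤i in
  trans (cong f (sym j+n≡i)) (stepInvariant⇒shiftInvariant f step j n)

private
  -- toℚ z is computed by normalisation, which is stuck on variables; this
  -- equal fraction with denominator 1 makes the field operations compute.
  fromℤ : ℤ → ℚ
  fromℤ z = mkℚ z 0 (Coprime.sym (Coprime.1-coprimeTo ℤ.∣ z ∣))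

  toℚ≡fromℤ : ∀ z → toℚ z ≡ fromℤ z
  toℚ≡fromℤ z = ℚP.↥p/↧p≡p (fromℤ z)

  fromℤ-homo‿- : ∀ z → fromℤ (ℤ.- z) ≡ ℚ.- fromℤ z
  fromℤ-homo‿- (+ zero)  = refl
  fromℤ-homo‿- ℤ.+[1+ n ] = refl
  fromℤ-homo‿- ℤ.-[1+ n ] = refl

toℚ-homo-* : ∀ a b → toℚ (a ℤ.* b) ≡ toℚ a ℚ.* toℚ b
toℚ-homo-* a b = sym (cong₂ ℚ._*_ (toℚ≡fromℤ a) (toℚ≡fromℤ b))

toℚ-homo-+ : ∀ a b → toℚ (a ℤ.+ b) ≡ toℚ a ℚ.+ toℚ b
toℚ-homo-+ a b = begin
  toℚ (a ℤ.+ b)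
    ≡⟨ cong₂ (λ x y → toℚ (x ℤ.+ y)) (sym (ℤP.*-identityʳ a)) (sym (ℤP.*-identityʳ b)) ⟩
  toℚ (a ℤ.* + 1 ℤ.+ b ℤ.* + 1)       ≡⟨⟩
  fromℤ a ℚ.+ fromℤ b                 ≡⟨ sym (cong₂ ℚ._+_ (toℚ≡fromℤ a) (toℚ≡fromℤ b)) ⟩
  toℚ a ℚ.+ toℚ b                     ∎

toℚ-homo‿- : ∀ a → toℚ (ℤ.- a) ≡ ℚ.- toℚ a
toℚ-homo‿- a = begin
  toℚ (ℤ.- a)       ≡⟨ toℚ≡fromℤ (ℤ.- a) ⟩
  fromℤ (ℤ.- a)     ≡⟨ fromℤ-homo‿- a ⟩
  ℚ.- fromℤ a       ≡⟨ cong ℚ.-_ (sym (toℚ≡fromℤ a)) ⟩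
  ℚ.- toℚ a         ∎

toℚ-homo-− : ∀ a b → toℚ (a ℤ.- b) ≡ toℚ a ℚ.- toℚ b
toℚ-homo-− a b = trans (toℚ-homo-+ a (ℤ.- b)) (cong (λ q → toℚ a ℚ.+ q) (toℚ-homo‿- b))

toℚ-homo-*−* : ∀ a b c d → toℚ (a ℤ.* b ℤ.- c ℤ.* d) ≡ toℚ a ℚ.* toℚ b ℚ.- toℚ c ℚ.* toℚ d
toℚ-homo-*−* a b c d =
  trans (toℚ-homo-− (a ℤ.* b) (c ℤ.* d)) (cong₂ ℚ._-_ (toℚ-homo-* a b) (toℚ-homo-* c d))

toℚ-injective : ∀ {a b} → toℚ a ≡ toℚ b → a ≡ b
toℚ-injective {a} {b} eq = cong ℚ.↥_ (trans (sym (toℚ≡fromℤ a)) (trans eq (toℚ≡fromℤ b)))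

toℚ-pos⇒≢0 : ∀ {z} → 0ℤ < z → toℚ z ≢ 0ℚ
toℚ-pos⇒≢0 0<z eq = ℤP.<⇒≢ 0<z (sym (toℚ-injective eq))

*-cancelʳ-≢0 : ∀ {p q r} → r ≢ 0ℚ → p ℚ.* r ≡ q ℚ.* r → p ≡ q
*-cancelʳ-≢0 {p} {q} {r} r≢0 eq = begin
  p                       ≡⟨ sym (ℚP.*-identityʳ p) ⟩
  p ℚ.* 1ℚ                ≡⟨ cong (p ℚ.*_) (sym (ℚP.*-inverseʳ r)) ⟩
  p ℚ.* (r ℚ.* 1/ r)      ≡⟨ sym (ℚP.*-assoc p r (1/ r)) ⟩
  (p ℚ.* r) ℚ.* 1/ r      ≡⟨ cong (ℚ._* 1/ r) eq ⟩
  (q ℚ.* r) ℚ.* 1/ r      ≡⟨ ℚP.*-assoc q r (1/ r) ⟩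
  q ℚ.* (r ℚ.* 1/ r)      ≡⟨ cong (q ℚ.*_) (ℚP.*-inverseʳ r) ⟩
  q ℚ.* 1ℚ                ≡⟨ ℚP.*-identityʳ q ⟩
  q                       ∎
  where instance _ = ℚ.≢-nonZero r≢0

p-x*r≡p-y*r⇒x≡y : ∀ {p x y r} → r ≢ 0ℚ → p ℚ.- x ℚ.* r ≡ p ℚ.- y ℚ.* r → x ≡ y
p-x*r≡p-y*r⇒x≡y {p} {x} {y} {r} r≢0 eq =
  *-cancelʳ-≢0 r≢0 (ℚP.neg-injective (∙-cancelˡ p (ℚ.- (x ℚ.* r)) (ℚ.- (y ℚ.* r)) eq))
  where open GroupProperties ℚP.+-0-group using (∙-cancelˡ)

module _ {v w : ℤ → ℤ → ℚ} (v-frieze : IsInfiniteFrieze v) (w-frieze : IsInfiniteFrieze w)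
         (w≢0 : ∀ k l → k < l → w k l ≢ 0ℚ)
         (same-quiddity : ∀ k → v k (k ℤ.+ + 2) ≡ w k (k ℤ.+ + 2)) where

  private
    Agree : ℤ → ℤ → Set
    Agree k l = v k l ≡ w k l

    AgreeOn : ℕ → Set
    AgreeOn n = ∀ k l → k ℤ.+ + n ≡ l → Agree k l

    agree-0 : AgreeOn 0
    agree-0 k l k+0≡l = subst (Agree k) (trans (sym (ℤP.+-identityʳ k)) k+0≡l)
                              (trans (proj₁ v-frieze k) (sym (proj₁ w-frieze k)))

    agree-1 : AgreeOn 1
    agree-1 k l k+1≡l = subst (Agree k) k+1≡l
                              (trans (proj₁ (proj₂ v-frieze) k) (sym (proj₁ (proj₂ w-frieze) k)))

    agree-2 : AgreeOn 2
    agree-2 k l k+2≡l = subst (Agree k) k+2≡l (same-quiddity k)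

    -- The unimodular rule on the block with corners (k, L) and (k+1, L+1)
    -- determines its entry at (k, L+1) from the other three, as w(k+1, L) ≠ 0.
    agree-step : ∀ n → AgreeOn (suc n) → AgreeOn (2 ℕ.+ n) → AgreeOn (3 ℕ.+ n)
    agree-step n near far k l L′≡l = subst (Agree k) (trans (sym L′≡L+1) L′≡l) agree-kL′
      where
      k′ = k ℤ.+ + 1
      L  = k ℤ.+ + suc (suc n)
      L′ = k ℤ.+ + suc (suc (suc n))
      L′≡L+1 : L′ ≡ L ℤ.+ + 1
      L′≡L+1 = i+[1+n]≡i+n+1 k (2 ℕ.+ n)
      k<L : k < L
      k<L = i<i+[1+n] k (suc n)
      w≢0′ : w k′ L ≢ 0ℚ
      w≢0′ = w≢0 k′ L (subst (k′ <_) (i+1+n≡i+[1+n] k (suc n)) (i<i+[1+n] k′ n))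
      agree-kL : Agree k L
      agree-kL = far k L refl
      agree-k′L+1 : Agree k′ (L ℤ.+ + 1)
      agree-k′L+1 = far k′ (L ℤ.+ + 1) (trans (i+1+n≡i+[1+n] k (2 ℕ.+ n)) L′≡L+1)
      agree-k′L : Agree k′ L
      agree-k′L = near k′ L (i+1+n≡i+[1+n] k (suc n))
      agree-kL′ : Agree k (L ℤ.+ + 1)
      agree-kL′ = p-x*r≡p-y*r⇒x≡y {w k L ℚ.* w k′ (L ℤ.+ + 1)} w≢0′ (begin
        w k L ℚ.* w k′ (L ℤ.+ + 1) ℚ.- v k (L ℤ.+ + 1) ℚ.* w k′ L
          ≡⟨ cong₂ (λ p r → p ℚ.- v k (L ℤ.+ + 1) ℚ.* r) (cong₂ ℚ._*_ agree-kL agree-k′L+1) agree-k′L ⟨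
        v k L ℚ.* v k′ (L ℤ.+ + 1) ℚ.- v k (L ℤ.+ + 1) ℚ.* v k′ L
          ≡⟨ proj₂ (proj₂ v-frieze) k L k<L ⟩
        1ℚ
          ≡⟨ proj₂ (proj₂ w-frieze) k L k<L ⟨
        w k L ℚ.* w k′ (L ℤ.+ + 1) ℚ.- w k (L ℤ.+ + 1) ℚ.* w k′ L ∎)

    agree-next : ∀ n → AgreeOn n → AgreeOn (suc n) → AgreeOn (2 ℕ.+ n)
    agree-next zero    _ _ = agree-2
    agree-next (suc n)     = agree-step n

    agree-all : ∀ n → AgreeOn n × AgreeOn (suc n)
    agree-all zero    = agree-0 , agree-1
    agree-all (suc n) = let here , next = agree-all n in next , agree-next n here next

  infiniteFrieze-unique : ∀ k l → k ≤ l → v k l ≡ w k l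
  infiniteFrieze-unique k l k≤l = let n , k+n≡l = i≤j⇒∃[n]i+n≡j k≤l in
    proj₁ (agree-all n) k l k+n≡l

ThreeTermRelation : (ℤ → ℤ → ℤ) → (ℤ → ℤ) → Set
ThreeTermRelation w x = ∀ a b c → w a c ℤ.* x b ≡ w b c ℤ.* x a ℤ.+ w a b ℤ.* x c

module _ {w : ℤ → ℤ → ℤ} (w-unit : ∀ k → w k (k ℤ.+ + 1) ≡ 1ℤ)
         {x : ℤ → ℤ} (three-term : ThreeTermRelation w x) where

  threeTerm-quiddity : ∀ k → w k (k ℤ.+ + 2) ℤ.* x (k ℤ.+ + 1) ≡ x k ℤ.+ x (k ℤ.+ + 2)
  threeTerm-quiddity k = begin
    w k k₂ ℤ.* x k₁                        ≡⟨ three-term k k₁ k₂ ⟩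
    w k₁ k₂ ℤ.* x k ℤ.+ w k k₁ ℤ.* x k₂    ≡⟨ cong₂ (λ p q → p ℤ.* x k ℤ.+ q ℤ.* x k₂) w-unit₁ (w-unit k) ⟩
    1ℤ ℤ.* x k ℤ.+ 1ℤ ℤ.* x k₂             ≡⟨ cong₂ ℤ._+_ (ℤP.*-identityˡ (x k)) (ℤP.*-identityˡ (x k₂)) ⟩
    x k ℤ.+ x k₂                           ∎
    where
    k₁ = k ℤ.+ + 1
    k₂ = k ℤ.+ + 2
    w-unit₁ : w k₁ k₂ ≡ 1ℤ
    w-unit₁ = subst (λ l → w k₁ l ≡ 1ℤ) (i+1+n≡i+[1+n] k 1) (w-unit k₁)

  -- Expanding w(k, l+1) x(l) = x(k) + w(k, l) x(l+1) propagates positivity along each row.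
  threeTerm-pos : (∀ k → 0ℤ < x k) → ∀ k l → k < l → 0ℤ < w k l
  threeTerm-pos x-pos k l k<l = let n , k+[1+n]≡l = i<j⇒∃[n]i+[1+n]≡j k<l in
    subst (λ l → 0ℤ < w k l) k+[1+n]≡l (pos-diagonal n)
    where
    pos-diagonal : ∀ n → 0ℤ < w k (k ℤ.+ + suc n)
    pos-diagonal zero    = subst (0ℤ <_) (sym (w-unit k)) (+<+ ℕ.z<s)
    pos-diagonal (suc n) = subst (λ l → 0ℤ < w k l) (sym (i+[1+n]≡i+n+1 k (suc n)))
      (ℤP.*-cancelʳ-<-nonNeg {0ℤ} {w k m′} (x m) {{ℤ.nonNegative (ℤP.<⇒≤ (x-pos m))}}
        (subst (0ℤ <_) (sym expansion)
          (ℤP.+-mono-< (x-pos k) (ℤP.*-monoʳ-<-pos (x m′) {{ℤ.positive (x-pos m′)}} (pos-diagonal n)))))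
      where
      m  = k ℤ.+ + suc n
      m′ = m ℤ.+ + 1
      expansion : w k m′ ℤ.* x m ≡ x k ℤ.+ w k m ℤ.* x m′
      expansion = trans (three-term k m m′)
        (cong (ℤ._+ w k m ℤ.* x m′) (trans (cong (ℤ._* x k) (w-unit m)) (ℤP.*-identityˡ (x k))))

columnFrieze : (ℤ → ℤ → ℤ) → ℤ → ℤ → ℤ → ℤ
columnFrieze u j k l = ℤ.- det2 (u k j) (u k (j ℤ.+ + 1)) (u l j) (u l (j ℤ.+ + 1))

module _ (u : ℤ → ℤ → ℤ) (j : ℤ) where

  open +-*-Solver

  private
    w = columnFrieze u j
    j′ = j ℤ.+ + 1

    minor : ∀ {n} → Polynomial n → Polynomial n → Polynomial n → Polynomial n → Polynomial n
    minor a₁ a₂ b₁ b₂ = :- (a₁ :* b₂ :- a₂ :* b₁)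

  columnFrieze-diag : ∀ k → columnFrieze u j k k ≡ 0ℤ
  columnFrieze-diag k = solve 2 (λ a₁ a₂ → minor a₁ a₂ a₁ a₂ := con 0ℤ) refl (u k j) (u k j′)

  columnFrieze-plücker : ∀ a b c d →
    w a c ℤ.* w b d ℤ.- w a d ℤ.* w b c ≡ w a b ℤ.* w c d
  columnFrieze-plücker a b c d =
    solve 8 (λ a₁ a₂ b₁ b₂ c₁ c₂ d₁ d₂ →
               minor a₁ a₂ c₁ c₂ :* minor b₁ b₂ d₁ d₂ :- minor a₁ a₂ d₁ d₂ :* minor b₁ b₂ c₁ c₂
            := minor a₁ a₂ b₁ b₂ :* minor c₁ c₂ d₁ d₂)
      refl (u a j) (u a j′) (u b j) (u b j′) (u c j) (u c j′) (u d j) (u d j′)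

  columnFrieze-threeTermˡ : ThreeTermRelation w (λ k → u k j)
  columnFrieze-threeTermˡ a b c =
    solve 6 (λ a₁ a₂ b₁ b₂ c₁ c₂ →
               minor a₁ a₂ c₁ c₂ :* b₁ := minor b₁ b₂ c₁ c₂ :* a₁ :+ minor a₁ a₂ b₁ b₂ :* c₁)
      refl (u a j) (u a j′) (u b j) (u b j′) (u c j) (u c j′)

  columnFrieze-threeTermʳ : ThreeTermRelation w (λ k → u k j′)
  columnFrieze-threeTermʳ a b c =
    solve 6 (λ a₁ a₂ b₁ b₂ c₁ c₂ →
               minor a₁ a₂ c₁ c₂ :* b₂ := minor b₁ b₂ c₁ c₂ :* a₂ :+ minor a₁ a₂ b₁ b₂ :* c₂)
      refl (u a j) (u a j′) (u b j) (u b j′) (u c j) (u c j′)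

module _ (u : ℤ → ℤ → ℤ) (tiling : IsSL2Tiling u) where

  columnFrieze-unit : ∀ j k → columnFrieze u j k (k ℤ.+ + 1) ≡ 1ℤ
  columnFrieze-unit j k =
    trans (solve 4 (λ a b c d → :- (a :* d :- b :* c) := c :* b :- a :* d) refl
                   (u k j) (u k (j ℤ.+ + 1)) (u (k ℤ.+ + 1) j) (u (k ℤ.+ + 1) (j ℤ.+ + 1)))
          (tiling k j)
    where open +-*-Solver

  columnFrieze-unimodular : ∀ j k l →
    let w = columnFrieze u j in
    w k l ℤ.* w (k ℤ.+ + 1) (l ℤ.+ + 1) ℤ.- w k (l ℤ.+ + 1) ℤ.* w (k ℤ.+ + 1) l ≡ 1ℤ
  columnFrieze-unimodular j k l = begin
    w k l ℤ.* w k′ l′ ℤ.- w k l′ ℤ.* w k′ l  ≡⟨ columnFrieze-plücker u j k k′ l l′ ⟩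
    w k k′ ℤ.* w l l′                        ≡⟨ cong₂ ℤ._*_ (columnFrieze-unit j k) (columnFrieze-unit j l) ⟩
    1ℤ                                       ∎
    where
    w = columnFrieze u j
    k′ = k ℤ.+ + 1
    l′ = l ℤ.+ + 1

  columnFrieze-quiddityˡ : ∀ j k →
    columnFrieze u j k (k ℤ.+ + 2) ℤ.* u (k ℤ.+ + 1) j ≡ u k j ℤ.+ u (k ℤ.+ + 2) j
  columnFrieze-quiddityˡ j =
    threeTerm-quiddity {columnFrieze u j} (columnFrieze-unit j) (columnFrieze-threeTermˡ u j)

  columnFrieze-quiddityʳ : ∀ j k →
    columnFrieze u j k (k ℤ.+ + 2) ℤ.* u (k ℤ.+ + 1) (j ℤ.+ + 1)
      ≡ u k (j ℤ.+ + 1) ℤ.+ u (k ℤ.+ + 2) (j ℤ.+ + 1)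
  columnFrieze-quiddityʳ j =
    threeTerm-quiddity {columnFrieze u j} (columnFrieze-unit j) (columnFrieze-threeTermʳ u j)

  columnFrieze-isInfiniteFrieze : ∀ j → IsInfiniteFrieze (λ k l → toℚ (columnFrieze u j k l))
  columnFrieze-isInfiniteFrieze j =
      (λ k → cong toℚ (columnFrieze-diag u j k))
    , (λ k → cong toℚ (columnFrieze-unit j k))
    , λ k l _ → trans (sym (toℚ-homo-*−* (w k l) (w (k ℤ.+ + 1) (l ℤ.+ + 1))
                                         (w k (l ℤ.+ + 1)) (w (k ℤ.+ + 1) l)))
                      (cong toℚ (columnFrieze-unimodular j k l))
    where w = columnFrieze u j

module _ (u : ℤ → ℤ → ℤ) (tiling : IsSL2Tiling u) (positive : IsPositive u) where

  columnFrieze-pos : ∀ j k l → k < l → 0ℤ < columnFrieze u j k l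
  columnFrieze-pos j =
    threeTerm-pos {columnFrieze u j} (columnFrieze-unit u tiling j) (columnFrieze-threeTermˡ u j)
                  (λ k → positive k j)

  -- Column j+1 satisfies the three-term relations of both column friezes j and j+1.
  columnFrieze-quiddity-step : ∀ j k →
    columnFrieze u (j ℤ.+ + 1) k (k ℤ.+ + 2) ≡ columnFrieze u j k (k ℤ.+ + 2)
  columnFrieze-quiddity-step j k =
    ℤP.*-cancelʳ-≡ _ _ (u k₁ j′) {{ℤ.>-nonZero (positive k₁ j′)}} (begin
      columnFrieze u j′ k k₂ ℤ.* u k₁ j′
        ≡⟨ columnFrieze-quiddityˡ u tiling j′ k ⟩
      u k j′ ℤ.+ u k₂ j′
        ≡⟨ columnFrieze-quiddityʳ u tiling j k ⟨
      columnFrieze u j k k₂ ℤ.* u k₁ j′ ∎)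
    where
    j′ = j ℤ.+ + 1
    k₁ = k ℤ.+ + 1
    k₂ = k ℤ.+ + 2

  columnFrieze-quiddity-independent : ∀ k j j₀ →
    columnFrieze u j k (k ℤ.+ + 2) ≡ columnFrieze u j₀ k (k ℤ.+ + 2)
  columnFrieze-quiddity-independent k =
    stepInvariant⇒constant (λ j → columnFrieze u j k (k ℤ.+ + 2))
                           (λ j → columnFrieze-quiddity-step j k)

  quiddity⇒columnFrieze-row₂ : ∀ {v : ℤ → ℤ → ℚ} j₀ →
    (∀ k → v (k ℤ.- + 1) (k ℤ.+ + 1) ℚ.* toℚ (u k j₀)
           ≡ toℚ (u (k ℤ.- + 1) j₀ ℤ.+ u (k ℤ.+ + 1) j₀)) →
    ∀ j k → v k (k ℤ.+ + 2) ≡ toℚ (columnFrieze u j k (k ℤ.+ + 2))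
  quiddity⇒columnFrieze-row₂ {v} j₀ quiddity j k = begin
    v k k₂                           ≡⟨ *-cancelʳ-≢0 (toℚ-pos⇒≢0 (positive k₁ j₀)) scaled ⟩
    toℚ (columnFrieze u j₀ k k₂)     ≡⟨ cong toℚ (columnFrieze-quiddity-independent k j₀ j) ⟩
    toℚ (columnFrieze u j k k₂)      ∎
    where
    k₁ = k ℤ.+ + 1
    k₂ = k ℤ.+ + 2
    scaled : v k k₂ ℚ.* toℚ (u k₁ j₀) ≡ toℚ (columnFrieze u j₀ k k₂) ℚ.* toℚ (u k₁ j₀)
    scaled = begin
      v k k₂ ℚ.* toℚ (u k₁ j₀)
        ≡⟨ subst₂ (λ a b → v a b ℚ.* toℚ (u k₁ j₀) ≡ toℚ (u a j₀ ℤ.+ u b j₀))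
                  (i+1-1≡i k) (i+1+n≡i+[1+n] k 1) (quiddity k₁) ⟩
      toℚ (u k j₀ ℤ.+ u k₂ j₀)
        ≡⟨ cong toℚ (columnFrieze-quiddityˡ u tiling j₀ k) ⟨
      toℚ (columnFrieze u j₀ k k₂ ℤ.* u k₁ j₀)
        ≡⟨ toℚ-homo-* (columnFrieze u j₀ k k₂) (u k₁ j₀) ⟩
      toℚ (columnFrieze u j₀ k k₂) ℚ.* toℚ (u k₁ j₀) ∎

proposition6p3 : (m n : ℕ) → m ≥ 1 → n ≥ 1 →
    (u : ℤ → ℤ → ℤ) → IsSL2Tiling u → IsPositive u → IsPeriodic m n u →
    (v : ℤ → ℤ → ℚ) → IsInfiniteFrieze v →
    (j₀ : ℤ) →
    (∀ k → v (k ℤ.- + 1) (k ℤ.+ + 1) ℚ.* toℚ (u k j₀)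
           ≡ toℚ (u (k ℤ.- + 1) j₀ ℤ.+ u (k ℤ.+ + 1) j₀)) →
    ∀ k l → k ≤ l → (j : ℤ) →
    v k l ≡ ℚ.- toℚ (det2 (u k j) (u k (j ℤ.+ + 1)) (u l j) (u l (j ℤ.+ + 1)))
proposition6p3 _ _ _ _ u tiling positive _ v v-frieze j₀ quiddity k l k≤l j =
  trans (infiniteFrieze-unique v-frieze (columnFrieze-isInfiniteFrieze u tiling j) nonzero
                               (quiddity⇒columnFrieze-row₂ u tiling positive {v} j₀ quiddity j) k l k≤l)
        (toℚ-homo‿- (det2 (u k j) (u k (j ℤ.+ + 1)) (u l j) (u l (j ℤ.+ + 1))))
  where
  nonzero : ∀ k l → k < l → toℚ (columnFrieze u j k l) ≢ 0ℚ
  nonzero k l k<l = toℚ-pos⇒≢0 (columnFrieze-pos u tiling positive j k l k<l)
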